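{- Let $\Lambda\subseteq\mathbb{R}^n$ be an integral lattice of minimum $m\le 7$ whose set of minimal vectors $S(\Lambda)$ forms a spherical $9$-design, write $S(\Lambda)=X\stackrel{\cdot}{\bigcup}-X$ (disjoint union) and $s:=|X|$. For all $\alpha\in S(\Lambda)$ put $s_i(\alpha):=|\{x\in X \mid (x,\alpha)=\pm i\}|$. Then the $s_i$ are independent of $\alpha$ and $s_i=0$ for $i>3$. Moreover, the following system of linear equations has non-negative integral solutions for $s_1,s_2,s_3$ and $s$: \[ \begin{pmatrix} 1&2^2&3^2\\1&2^4&3^4\\1&2^6&3^6\\1&2^8&3^8 \end{pmatrix} \begin{pmatrix}s_1\\ s_2\\ s_3 \end{pmatrix}= \begin{pmatrix}\frac{sm^2}{n} -m^2\\ \frac{3sm^4}{n(n+2)}-m^4\\ \frac{15sm^6}{n(n+2)(n+4)}-m^6\\ \frac{105sm^8}{n(n+2)(n+4)(n+6)}-m^8 \end{pmatrix}. \]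
   Context: Here $S(\Lambda):=\{l\in\Lambda \mid (l,l)=\min(\Lambda)\}$ with $\min(\Lambda):=\min\{(x,x)\mid 0\neq x\in\Lambda\}$. A finite set $X=-X$ on the sphere of radius $m$ is a spherical $2t+1$-design iff $\sum_{x\in X}(x,\alpha)^{2i}=c_i|X|m^i(\alpha,\alpha)^i$ with $c_i=\prod_{k=0}^{i-1}\frac{1+2k}{n-2k}$ for all $i\le t$ and all $\alpha\in\mathbb{R}^n$. -}

module Defs where

open import Data.Nat as ℕ using (ℕ; zero; suc; NonZero; _≤_; _<_)
open import Data.Integer as ℤ using (ℤ; +_)
open import Data.Rational as ℚ using (ℚ; 0ℚ; 1ℚ; _/_)
open import Data.Fin using (Fin; zero; suc)
open import Data.Vec using (Vec; lookup; map; replicate)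
open import Data.Nat.Properties using (≤-trans; m≤n+m)
open import Data.Vec.Properties using (≡-dec)
open import Data.List as List using (List; []; _∷_; length; filterᵇ)
open import Data.List.Membership.Propositional using (_∈_)
open import Data.Bool using (Bool; _∧_; _∨_; not)
open import Data.Product using (Σ; ∃; _×_; _,_)
open import Relation.Nullary using (¬_; does)
open import Relation.Binary.PropositionalEquality using (_≡_; _≢_)

∑ : ∀ {n} → (Fin n → ℤ) → ℤ
∑ {zero}  f = + 0
∑ {suc n} f = f zero ℤ.+ ∑ (λ i → f (suc i))

∑ℚ : ∀ {n} → (Fin n → ℚ) → ℚ
∑ℚ {zero}  f = 0ℚ
∑ℚ {suc n} f = f zero ℚ.+ ∑ℚ (λ i → f (suc i))

sumℚ : List ℚ → ℚ
sumℚ = List.foldr ℚ._+_ 0ℚ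

_^ℚ_ : ℚ → ℕ → ℚ
q ^ℚ zero  = 1ℚ
q ^ℚ suc k = q ℚ.* (q ^ℚ k)

ℕ→ℚ : ℕ → ℚ
ℕ→ℚ k = + k / 1

ℤ→ℚ : ℤ → ℚ
ℤ→ℚ z = z / 1

-- A lattice of rank n is given by the Gram matrix G of a basis; lattice
-- vectors are integer coordinate vectors w.r.t. that basis, and real vectors
-- of the ambient space are coordinate vectors (here with rational coordinates).
Gram : ℕ → Set
Gram n = Fin n → Fin n → ℤ

Symmetric : ∀ {n} → Gram n → Set
Symmetric G = ∀ i j → G i j ≡ G j i

ip : ∀ {n} → Gram n → Vec ℤ n → Vec ℤ n → ℤ
ip G x y = ∑ (λ i → ∑ (λ j → lookup x i ℤ.* G i j ℤ.* lookup y j))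

ipℚ : ∀ {n} → Gram n → (Fin n → ℚ) → (Fin n → ℚ) → ℚ
ipℚ G a b = ∑ℚ (λ i → ∑ℚ (λ j → a i ℚ.* ℤ→ℚ (G i j) ℚ.* b j))

toℚ : ∀ {n} → Vec ℤ n → (Fin n → ℚ)
toℚ x i = ℤ→ℚ (lookup x i)

neg : ∀ {n} → Vec ℤ n → Vec ℤ n
neg = map (λ z → ℤ.- z)

0v : ∀ {n} → Vec ℤ n
0v = replicate _ (+ 0)

-- positive definiteness of the Gram matrix (so G is the Gram matrix of a
-- basis of a full-rank lattice in ℝ^n)
PositiveDefinite : ∀ {n} → Gram n → Set
PositiveDefinite {n} G =
  ∀ (a : Fin n → ℚ) → (∃ λ i → a i ≢ 0ℚ) → 0ℚ ℚ.< ipℚ G a a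

-- the lattice is integral: all inner products of lattice vectors are integers
-- (automatic in this model since G has integer entries)

IsMin : ∀ {n} → Gram n → ℕ → Set
IsMin G m = (∃ λ x → x ≢ 0v × ip G x x ≡ + m)
          × (∀ x → x ≢ 0v → + m ℤ.≤ ip G x x)

EnumeratesMinVecs : ∀ {n} → Gram n → ℕ → List (Vec ℤ n) → Set
EnumeratesMinVecs G m S = ∀ x → (x ∈ S → ip G x x ≡ + m) × (ip G x x ≡ + m → x ∈ S)

nz+ : ∀ k n → .{{_ : NonZero n}} → NonZero (k ℕ.+ n)
nz+ k n = ℕ.>-nonZero (≤-trans (ℕ.>-nonZero⁻¹ n) (m≤n+m n k))

c : (n : ℕ) → .{{_ : NonZero n}} → ℕ → ℚ
c n zero    = 1ℚ
c n (suc i) = c n i ℚ.* _/_ (+ (1 ℕ.+ 2 ℕ.* i)) (2 ℕ.* i ℕ.+ n) {{nz+ (2 ℕ.* i) n}}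

-- A finite set X = -X on the sphere of squared radius m is a spherical
-- (2t+1)-design: ∑_{x∈X} (x,α)^{2i} = c_i |X| m^i (α,α)^i for i ≤ t, all α.
IsSphericalDesign : ∀ {n} .{{_ : NonZero n}} → Gram n → ℕ → ℕ → List (Vec ℤ n) → Set
IsSphericalDesign {n} G m t X =
    (∀ x → x ∈ X → neg x ∈ X)
  × (∀ x → x ∈ X → ip G x x ≡ + m)
  × (∀ i → i ≤ t → ∀ (α : Fin n → ℚ) →
       sumℚ (List.map (λ x → ipℚ G (toℚ x) α ^ℚ (2 ℕ.* i)) X)
       ≡ c n i ℚ.* ℕ→ℚ (length X) ℚ.* (ℕ→ℚ m ^ℚ i) ℚ.* (ipℚ G α α ^ℚ i))

sIdx : ∀ {n} → Gram n → List (Vec ℤ n) → Vec ℤ n → ℕ → ℕ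
sIdx G X α i = length (filterᵇ test X)
  where
  test : _ → Bool
  test x = not (does (≡-dec ℤ._≟_ x α)) ∧ not (does (≡-dec ℤ._≟_ x (neg α)))
         ∧ (does (ip G x α ℤ.≟ + i) ∨ does (ip G x α ℤ.≟ ℤ.- (+ i)))

{-# OPTIONS --safe #-}
-- If x, α are minimal vectors with x ≠ ±α, then m ≤ (x ∓ α, x ∓ α) = 2m ∓ 2(x, α), so
-- 2|(x, α)| ≤ m ≤ 7 and |(x, α)| ≤ 3.  As exactly one of ±α lies in X, for every α ∈ S
--   Σ_{x ∈ X} (x, α)^{2k} = m^{2k} + s₁ + 2^{2k} s₂ + 3^{2k} s₃,
-- while x ↦ (x, α)^{2k} is even, so the sum over S = X ∪ -X is twice this, and the design
-- property (k ≤ 4) evaluates it, giving the k-th equation.  Its right-hand side does not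
-- depend on α, and the equations for k = 1, 2, 3 determine s₁, s₂, s₃.
module Submission where

open import Defs
open import Data.Nat using (ℕ; NonZero; _≤_; _<_)
import Data.Nat
open import Data.Integer using (ℤ; +_)
open import Data.Rational using (ℚ; _+_; _*_; _-_; _/_)
open import Data.Vec using (Vec)
open import Data.List using (List; _++_; map; length)
open import Data.List.Membership.Propositional using (_∈_)
open import Data.List.Relation.Unary.Unique.Propositional using (Unique)
open import Data.List.Relation.Binary.Permutation.Propositional using (_↭_)
open import Data.Product using (∃; _×_)
open import Relation.Binary.PropositionalEquality using (_≡_)

open import Algebra.Definitions using (Congruent₂)
import Algebra.Properties.Semiring.Sum as SemiringSum
open import Data.Bool using (Bool; true; false; not; _∧_; _∨_; T)
open import Data.Bool.Properties using (∨-identityʳ; ∧-zeroʳ)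
open import Data.Empty using (⊥-elim)
open import Data.Fin using (Fin; zero; suc)
open import Data.Integer as ℤ using (-[1+_]; ∣_∣)
import Data.Integer.Properties as ℤP
import Data.Integer.Tactic.RingSolver as ℤ-Ring
open import Data.List using ([]; _∷_; filter)
open import Data.List.Membership.Propositional.Properties using (∈-++⁺ˡ)
open import Data.List.Properties
  using (map-∘; map-cong-local; length-++; length-map; filter-none; filter-accept; filter-reject)
import Data.List.Relation.Unary.All as All
open import Data.List.Relation.Unary.AllPairs using (_∷_)
open import Data.List.Relation.Unary.Any using (here; there)
open import Data.List.Relation.Binary.Permutation.Propositional using (↭⇒↭ₛ)
open import Data.List.Relation.Binary.Permutation.Propositional.Properties using (map⁺; ↭-length; ∈-resp-↭)
import Data.List.Relation.Binary.Permutation.Setoid.Properties as SetoidPermutation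
open import Data.Nat as ℕ using (zero; suc; z≤n; s≤s)
import Data.Nat.Properties as ℕP
open import Data.Product using (_,_; proj₁; proj₂)
open import Data.Rational as ℚ using (0ℚ; 1ℚ)
import Data.Rational.Properties as ℚP
open import Data.Rational.Unnormalised as ℚᵘ using (ℚᵘ; mkℚᵘ; *≡*)
import Data.Rational.Unnormalised.Properties as ℚᵘP
open import Data.Sum using (_⊎_; inj₁; inj₂)
open import Data.Vec using ([]; _∷_; lookup; zipWith)
open import Data.Vec.Properties using (≡-dec; lookup-map; lookup-zipWith; ∷-injectiveˡ; ∷-injectiveʳ)
open import Function using (_∘_; flip)
open import Function.Bundles using (mk⇔)
open import Level using (0ℓ)
open import Relation.Binary.Definitions using (DecidableEquality)
open import Relation.Binary.PropositionalEquality
  using (_≢_; refl; sym; trans; cong; cong₂; subst; subst₂; setoid; module ≡-Reasoning)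
open import Relation.Nullary using (Dec; does; yes; no)
open import Relation.Nullary.Decidable using (dec-true; dec-false; does-⇔)
open import Relation.Nullary.Decidable.Core using (dec⇒maybe; T?)
open import Relation.Unary using (Pred; Decidable)
open import Tactic.RingSolver using (solve-∀)
import Tactic.RingSolver.Core.AlmostCommutativeRing as ACR

ℚ-ring : ACR.AlmostCommutativeRing 0ℓ 0ℓ
ℚ-ring = ACR.fromCommutativeRing ℚP.+-*-commutativeRing (λ q → dec⇒maybe (0ℚ ℚP.≟ q))

fromℚᵘ-homo₂ : ∀ {_∙_ : ℚ → ℚ → ℚ} {_∘ᵘ_ : ℚᵘ → ℚᵘ → ℚᵘ} →
               (∀ p q → ℚ.toℚᵘ (p ∙ q) ℚᵘ.≃ ℚ.toℚᵘ p ∘ᵘ ℚ.toℚᵘ q) → Congruent₂ ℚᵘ._≃_ _∘ᵘ_ →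
               ∀ p q → ℚ.fromℚᵘ (p ∘ᵘ q) ≡ ℚ.fromℚᵘ p ∙ ℚ.fromℚᵘ q
fromℚᵘ-homo₂ {_∙_} {_∘ᵘ_} homo ∘ᵘ-cong p q = ℚP.toℚᵘ-injective (begin
  ℚ.toℚᵘ (ℚ.fromℚᵘ (p ∘ᵘ q))                  ≈⟨ ℚP.toℚᵘ-fromℚᵘ (p ∘ᵘ q) ⟩
  p ∘ᵘ q
    ≈⟨ ∘ᵘ-cong (ℚᵘP.≃-sym (ℚP.toℚᵘ-fromℚᵘ p)) (ℚᵘP.≃-sym (ℚP.toℚᵘ-fromℚᵘ q)) ⟩
  ℚ.toℚᵘ (ℚ.fromℚᵘ p) ∘ᵘ ℚ.toℚᵘ (ℚ.fromℚᵘ q)  ≈⟨ ℚᵘP.≃-sym (homo _ _) ⟩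
  ℚ.toℚᵘ (ℚ.fromℚᵘ p ∙ ℚ.fromℚᵘ q)            ∎)
  where open ℚᵘP.≃-Reasoning

-- ℤ→ℚ z is definitionally ℚ.fromℚᵘ (mkℚᵘ z 0).
ℤ→ℚ-homo-+ : ∀ a b → ℤ→ℚ (a ℤ.+ b) ≡ ℤ→ℚ a + ℤ→ℚ b
ℤ→ℚ-homo-+ a b =
  trans (ℚP.fromℚᵘ-cong {mkℚᵘ (a ℤ.+ b) 0} {mkℚᵘ a 0 ℚᵘ.+ mkℚᵘ b 0} (*≡* (unit a b)))
        (fromℚᵘ-homo₂ ℚP.toℚᵘ-homo-+ ℚᵘP.+-cong (mkℚᵘ a 0) (mkℚᵘ b 0))
  where
  unit : ∀ a b → (a ℤ.+ b) ℤ.* + 1 ≡ (a ℤ.* + 1 ℤ.+ b ℤ.* + 1) ℤ.* + 1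
  unit = ℤ-Ring.solve-∀

ℤ→ℚ-homo-* : ∀ a b → ℤ→ℚ (a ℤ.* b) ≡ ℤ→ℚ a * ℤ→ℚ b
ℤ→ℚ-homo-* a b = fromℚᵘ-homo₂ ℚP.toℚᵘ-homo-* ℚᵘP.*-cong (mkℚᵘ a 0) (mkℚᵘ b 0)

ℤ→ℚ-injective : ∀ {a b} → ℤ→ℚ a ≡ ℤ→ℚ b → a ≡ b
ℤ→ℚ-injective {a} {b} eq with ℚP.fromℚᵘ-injective {mkℚᵘ a 0} {mkℚᵘ b 0} eq
... | *≡* a*1≡b*1 = ℤP.*-cancelʳ-≡ a b (+ 1) a*1≡b*1

ℕ→ℚ-homo-+ : ∀ a b → ℕ→ℚ (a ℕ.+ b) ≡ ℕ→ℚ a + ℕ→ℚ b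
ℕ→ℚ-homo-+ a b = ℤ→ℚ-homo-+ (+ a) (+ b)

ℕ→ℚ-homo-* : ∀ a b → ℕ→ℚ (a ℕ.* b) ≡ ℕ→ℚ a * ℕ→ℚ b
ℕ→ℚ-homo-* a b = trans (cong ℤ→ℚ (ℤP.pos-* a b)) (ℤ→ℚ-homo-* (+ a) (+ b))

ℕ→ℚ-homo-^ : ∀ a k → ℕ→ℚ (a ℕ.^ k) ≡ ℕ→ℚ a ^ℚ k
ℕ→ℚ-homo-^ a zero    = refl
ℕ→ℚ-homo-^ a (suc k) = trans (ℕ→ℚ-homo-* a (a ℕ.^ k)) (cong (ℕ→ℚ a *_) (ℕ→ℚ-homo-^ a k))

ℕ→ℚ-injective : ∀ {a b} → ℕ→ℚ a ≡ ℕ→ℚ b → a ≡ b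
ℕ→ℚ-injective eq = ℤP.+-injective (ℤ→ℚ-injective eq)

n/d≡n*[1/d] : ∀ k d .{{_ : NonZero d}} → + k / d ≡ ℕ→ℚ k * (+ 1 / d)
n/d≡n*[1/d] k (suc d) =
  trans (ℚP.fromℚᵘ-cong {mkℚᵘ (+ k) d} {mkℚᵘ (+ k) 0 ℚᵘ.* mkℚᵘ (+ 1) d} (*≡* (cross k d)))
        (fromℚᵘ-homo₂ ℚP.toℚᵘ-homo-* ℚᵘP.*-cong (mkℚᵘ (+ k) 0) (mkℚᵘ (+ 1) d))
  where
  cross : ∀ k d → + k ℤ.* + suc (d ℕ.+ 0) ≡ (+ k ℤ.* + 1) ℤ.* + suc d
  cross k d rewrite ℕP.+-identityʳ d = cong (ℤ._* + suc d) (sym (ℤP.*-identityʳ (+ k)))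

^ℚ-even : ∀ q k → q ^ℚ (2 ℕ.* k) ≡ (q * q) ^ℚ k
^ℚ-even q zero    = refl
^ℚ-even q (suc k) = begin
  q * q ^ℚ (k ℕ.+ suc (k ℕ.+ 0)) ≡⟨ cong (λ e → q * q ^ℚ e) (ℕP.+-suc k (k ℕ.+ 0)) ⟩
  q * (q * q ^ℚ (2 ℕ.* k))       ≡⟨ ℚP.*-assoc q q _ ⟨
  q * q * q ^ℚ (2 ℕ.* k)         ≡⟨ cong (q * q *_) (^ℚ-even q k) ⟩
  (q * q) * (q * q) ^ℚ k         ∎
  where open ≡-Reasoning

^ℚ-distrib-* : ∀ p q k → (p * q) ^ℚ k ≡ p ^ℚ k * q ^ℚ k
^ℚ-distrib-* p q zero    = refl
^ℚ-distrib-* p q (suc k) = trans (cong (p * q *_) (^ℚ-distrib-* p q k)) (interchange p q _ _)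
  where
  interchange : ∀ a b c d → a * b * (c * d) ≡ a * c * (b * d)
  interchange = solve-∀ ℚ-ring

i*i≡∣i∣*∣i∣ : ∀ v → v ℤ.* v ≡ + (∣ v ∣ ℕ.* ∣ v ∣)
i*i≡∣i∣*∣i∣ (+ k)    = sym (ℤP.pos-* k k)
i*i≡∣i∣*∣i∣ -[1+ k ] = refl

even-power-∣∣ : ∀ v k → ℤ→ℚ v ^ℚ (2 ℕ.* k) ≡ ℕ→ℚ ((∣ v ∣ ℕ.* ∣ v ∣) ℕ.^ k)
even-power-∣∣ v k = begin
  ℤ→ℚ v ^ℚ (2 ℕ.* k)            ≡⟨ ^ℚ-even (ℤ→ℚ v) k ⟩
  (ℤ→ℚ v * ℤ→ℚ v) ^ℚ k          ≡⟨ cong (_^ℚ k) (trans (sym (ℤ→ℚ-homo-* v v)) (cong ℤ→ℚ (i*i≡∣i∣*∣i∣ v))) ⟩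
  ℕ→ℚ (∣ v ∣ ℕ.* ∣ v ∣) ^ℚ k      ≡⟨ ℕ→ℚ-homo-^ _ k ⟨
  ℕ→ℚ ((∣ v ∣ ℕ.* ∣ v ∣) ℕ.^ k)  ∎
  where open ≡-Reasoning

module _ {A : Set} where

  sumℚ-++ : ∀ (f : A → ℚ) xs ys → sumℚ (map f (xs ++ ys)) ≡ sumℚ (map f xs) + sumℚ (map f ys)
  sumℚ-++ f []       ys = sym (ℚP.+-identityˡ _)
  sumℚ-++ f (x ∷ xs) ys = trans (cong (f x ℚ.+_) (sumℚ-++ f xs ys)) (sym (ℚP.+-assoc (f x) _ _))

  sumℚ-+ : ∀ (f g : A → ℚ) xs → sumℚ (map (λ x → f x + g x) xs) ≡ sumℚ (map f xs) + sumℚ (map g xs)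
  sumℚ-+ f g []       = refl
  sumℚ-+ f g (x ∷ xs) = trans (cong (f x + g x ℚ.+_) (sumℚ-+ f g xs)) (interchange (f x) (g x) _ _)
    where
    interchange : ∀ a b c d → a + b + (c + d) ≡ a + c + (b + d)
    interchange = solve-∀ ℚ-ring

  sumℚ-*ˡ : ∀ c (f : A → ℚ) xs → sumℚ (map (λ x → c * f x) xs) ≡ c * sumℚ (map f xs)
  sumℚ-*ˡ c f []       = sym (ℚP.*-zeroʳ c)
  sumℚ-*ˡ c f (x ∷ xs) = trans (cong (c * f x ℚ.+_) (sumℚ-*ˡ c f xs)) (sym (ℚP.*-distribˡ-+ c (f x) _))

  sumℚ-*ʳ : ∀ c (f : A → ℚ) xs → sumℚ (map (λ x → f x * c) xs) ≡ sumℚ (map f xs) * c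
  sumℚ-*ʳ c f []       = sym (ℚP.*-zeroˡ c)
  sumℚ-*ʳ c f (x ∷ xs) = trans (cong (f x * c ℚ.+_) (sumℚ-*ʳ c f xs)) (sym (ℚP.*-distribʳ-+ c (f x) _))

  sumℚ-cong : ∀ {f g : A → ℚ} {xs} → (∀ {x} → x ∈ xs → f x ≡ g x) → sumℚ (map f xs) ≡ sumℚ (map g xs)
  sumℚ-cong f≗g = cong sumℚ (map-cong-local (All.tabulate f≗g))

  sumℚ-↭ : ∀ (f : A → ℚ) {xs ys} → xs ↭ ys → sumℚ (map f xs) ≡ sumℚ (map f ys)
  sumℚ-↭ f xs↭ys =
    SetoidPermutation.foldr-commMonoid (setoid ℚ) ℚP.+-0-isCommutativeMonoid (↭⇒↭ₛ (map⁺ f xs↭ys))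

  sumℚ-↭-++-map : ∀ (f : A → ℚ) (g : A → A) xs {ys} → xs ++ map g xs ↭ ys →
                  sumℚ (map f ys) ≡ sumℚ (map (λ x → f x + f (g x)) xs)
  sumℚ-↭-++-map f g xs {ys} split = begin
    sumℚ (map f ys)                            ≡⟨ sumℚ-↭ f split ⟨
    sumℚ (map f (xs ++ map g xs))              ≡⟨ sumℚ-++ f xs (map g xs) ⟩
    sumℚ (map f xs) + sumℚ (map f (map g xs))  ≡⟨ cong (λ ys → sumℚ (map f xs) + sumℚ ys) (map-∘ xs) ⟨
    sumℚ (map f xs) + sumℚ (map (f ∘ g) xs)    ≡⟨ sumℚ-+ f (f ∘ g) xs ⟨
    sumℚ (map (λ x → f x + f (g x)) xs)        ∎
    where open ≡-Reasoning

ind : Bool → ℚ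
ind true  = 1ℚ
ind false = 0ℚ

module _ {A : Set} {p} {P : Pred A p} (P? : Decidable P) where

  sumℚ-ind : ∀ xs → sumℚ (map (λ x → ind (does (P? x))) xs) ≡ ℕ→ℚ (length (filter P? xs))
  sumℚ-ind []       = refl
  sumℚ-ind (x ∷ xs) with does (P? x)
  ... | true  = trans (cong (1ℚ ℚ.+_) (sumℚ-ind xs)) (sym (ℕ→ℚ-homo-+ 1 (length (filter P? xs))))
  ... | false = trans (ℚP.+-identityˡ _) (sumℚ-ind xs)

module _ {A : Set} (_≟_ : DecidableEquality A) where

  length-filter-≟-unique : ∀ {x xs} → Unique xs → x ∈ xs → length (filter (_≟ x) xs) ≡ 1
  length-filter-≟-unique {x} {_ ∷ ys} (x∉ys ∷ _) (here refl) =
    trans (cong length (filter-accept (_≟ x) refl))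
          (cong (suc ∘ length) (filter-none (_≟ x) (All.map (λ x≢y y≡x → x≢y (sym y≡x)) x∉ys)))
  length-filter-≟-unique {x} {y ∷ ys} (y∉ys ∷ u) (there x∈ys) =
    trans (cong length (filter-reject (_≟ x) (All.lookup y∉ys x∈ys))) (length-filter-≟-unique u x∈ys)

private
  module ℤSum = SemiringSum ℤP.+-*-semiring

∑≡sum : ∀ {n} (f : Fin n → ℤ) → ∑ f ≡ ℤSum.sum f
∑≡sum {zero}  f = refl
∑≡sum {suc n} f = cong (λ t → f zero ℤ.+ t) (∑≡sum (λ i → f (suc i)))

∑-cong : ∀ {n} {f g : Fin n → ℤ} → (∀ i → f i ≡ g i) → ∑ f ≡ ∑ g
∑-cong {f = f} {g} f≗g = trans (∑≡sum f) (trans (ℤSum.sum-cong-≗ f≗g) (sym (∑≡sum g)))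

∑-+ : ∀ {n} (f g : Fin n → ℤ) → ∑ (λ i → f i ℤ.+ g i) ≡ ∑ f ℤ.+ ∑ g
∑-+ f g = begin
  ∑ (λ i → f i ℤ.+ g i)         ≡⟨ ∑≡sum (λ i → f i ℤ.+ g i) ⟩
  ℤSum.sum (λ i → f i ℤ.+ g i)  ≡⟨ ℤSum.∑-distrib-+ f g ⟩
  ℤSum.sum f ℤ.+ ℤSum.sum g     ≡⟨ cong₂ ℤ._+_ (∑≡sum f) (∑≡sum g) ⟨
  ∑ f ℤ.+ ∑ g                   ∎
  where open ≡-Reasoning

∑-neg : ∀ {n} (f : Fin n → ℤ) → ∑ (λ i → ℤ.- f i) ≡ ℤ.- ∑ f
∑-neg f = begin
  ∑ (λ i → ℤ.- f i)               ≡⟨ ∑-cong (λ i → sym (ℤP.-1*i≡-i (f i))) ⟩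
  ∑ (λ i → ℤ.-1ℤ ℤ.* f i)         ≡⟨ ∑≡sum (λ i → ℤ.-1ℤ ℤ.* f i) ⟩
  ℤSum.sum (λ i → ℤ.-1ℤ ℤ.* f i)  ≡⟨ ℤSum.*-distribˡ-sum ℤ.-1ℤ f ⟨
  ℤ.-1ℤ ℤ.* ℤSum.sum f            ≡⟨ cong (ℤ.-1ℤ ℤ.*_) (∑≡sum f) ⟨
  ℤ.-1ℤ ℤ.* ∑ f                   ≡⟨ ℤP.-1*i≡-i (∑ f) ⟩
  ℤ.- ∑ f                         ∎
  where open ≡-Reasoning

∑-comm : ∀ {n k} (f : Fin n → Fin k → ℤ) → ∑ (λ i → ∑ (f i)) ≡ ∑ (λ j → ∑ (λ i → f i j))
∑-comm f = begin
  ∑ (λ i → ∑ (f i))                        ≡⟨ ∑∑≡sum-sum f ⟩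
  ℤSum.sum (λ i → ℤSum.sum (f i))          ≡⟨ ℤSum.∑-comm f ⟩
  ℤSum.sum (λ j → ℤSum.sum (λ i → f i j))  ≡⟨ ∑∑≡sum-sum (λ j i → f i j) ⟨
  ∑ (λ j → ∑ (λ i → f i j))                ∎
  where
  open ≡-Reasoning
  ∑∑≡sum-sum : ∀ {n k} (g : Fin n → Fin k → ℤ) → ∑ (λ i → ∑ (g i)) ≡ ℤSum.sum (λ i → ℤSum.sum (g i))
  ∑∑≡sum-sum g = trans (∑≡sum (λ i → ∑ (g i))) (ℤSum.sum-cong-≗ (λ i → ∑≡sum (g i)))

∑ℚ-ℤ→ℚ : ∀ {n} {g : Fin n → ℚ} {f : Fin n → ℤ} → (∀ i → g i ≡ ℤ→ℚ (f i)) → ∑ℚ g ≡ ℤ→ℚ (∑ f)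
∑ℚ-ℤ→ℚ {zero}          _   = refl
∑ℚ-ℤ→ℚ {suc n} {f = f} g≗f =
  trans (cong₂ _+_ (g≗f zero) (∑ℚ-ℤ→ℚ (g≗f ∘ suc))) (sym (ℤ→ℚ-homo-+ (f zero) (∑ (f ∘ suc))))

_+ᵥ_ : ∀ {n} → Vec ℤ n → Vec ℤ n → Vec ℤ n
_+ᵥ_ = zipWith ℤ._+_

_≟ᵥ_ : ∀ {n} → DecidableEquality (Vec ℤ n)
_≟ᵥ_ = ≡-dec ℤ._≟_

neg-involutive : ∀ {n} (x : Vec ℤ n) → neg (neg x) ≡ x
neg-involutive []      = refl
neg-involutive (a ∷ x) = cong₂ _∷_ (ℤP.neg-involutive a) (neg-involutive x)

does-≟ᵥ-neg : ∀ {n} (x y : Vec ℤ n) → does (x ≟ᵥ neg y) ≡ does (neg x ≟ᵥ y)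
does-≟ᵥ-neg x y = does-⇔ (mk⇔ (λ x≡-y → trans (cong neg x≡-y) (neg-involutive y))
                               (λ -x≡y → trans (sym (neg-involutive x)) (cong neg -x≡y)))
                         (x ≟ᵥ neg y) (neg x ≟ᵥ y)

+ᵥ≡0v⇒≡neg : ∀ {n} (x y : Vec ℤ n) → x +ᵥ y ≡ 0v → x ≡ neg y
+ᵥ≡0v⇒≡neg []      []      _  = refl
+ᵥ≡0v⇒≡neg (a ∷ x) (b ∷ y) eq =
  cong₂ _∷_ (ℤP.i-j≡0⇒i≡j a (ℤ.- b) a--b≡0) (+ᵥ≡0v⇒≡neg x y (∷-injectiveʳ eq))
  where
  a--b≡0 : a ℤ.- ℤ.- b ≡ + 0
  a--b≡0 = trans (cong (λ t → a ℤ.+ t) (ℤP.neg-involutive b)) (∷-injectiveˡ eq)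

entry : ∀ {n} → Gram n → Vec ℤ n → Vec ℤ n → Fin n → Fin n → ℤ
entry G x y i j = lookup x i ℤ.* G i j ℤ.* lookup y j

ipℚ-toℚ : ∀ {n} (G : Gram n) x y → ipℚ G (toℚ x) (toℚ y) ≡ ℤ→ℚ (ip G x y)
ipℚ-toℚ G x y = ∑ℚ-ℤ→ℚ {f = λ i → ∑ (entry G x y i)} λ i → ∑ℚ-ℤ→ℚ {f = entry G x y i} λ j →
  sym (trans (ℤ→ℚ-homo-* (lookup x i ℤ.* G i j) (lookup y j))
             (cong (_* ℤ→ℚ (lookup y j)) (ℤ→ℚ-homo-* (lookup x i) (G i j))))

module _ {n} (G : Gram n) where

  ip-+ˡ : ∀ x y z → ip G (x +ᵥ y) z ≡ ip G x z ℤ.+ ip G y z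
  ip-+ˡ x y z = trans (∑-cong λ i → trans (∑-cong (term i)) (∑-+ (entry G x z i) (entry G y z i)))
                      (∑-+ (λ i → ∑ (entry G x z i)) (λ i → ∑ (entry G y z i)))
    where
    distrib : ∀ a b g c → (a ℤ.+ b) ℤ.* g ℤ.* c ≡ a ℤ.* g ℤ.* c ℤ.+ b ℤ.* g ℤ.* c
    distrib = ℤ-Ring.solve-∀
    term : ∀ i j → entry G (x +ᵥ y) z i j ≡ entry G x z i j ℤ.+ entry G y z i j
    term i j rewrite lookup-zipWith ℤ._+_ i x y = distrib (lookup x i) (lookup y i) (G i j) (lookup z j)

  ip-negˡ : ∀ x y → ip G (neg x) y ≡ ℤ.- ip G x y
  ip-negˡ x y = trans (∑-cong λ i → trans (∑-cong (term i)) (∑-neg (entry G x y i)))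
                      (∑-neg (λ i → ∑ (entry G x y i)))
    where
    neg-distrib : ∀ a g c → ℤ.- a ℤ.* g ℤ.* c ≡ ℤ.- (a ℤ.* g ℤ.* c)
    neg-distrib = ℤ-Ring.solve-∀
    term : ∀ i j → entry G (neg x) y i j ≡ ℤ.- entry G x y i j
    term i j rewrite lookup-map i ℤ.-_ x = neg-distrib (lookup x i) (G i j) (lookup y j)

module _ {n} {G : Gram n} (G-sym : Symmetric G) where

  ip-comm : ∀ x y → ip G x y ≡ ip G y x
  ip-comm x y = trans (∑-comm (entry G x y)) (∑-cong λ j → ∑-cong (term j))
    where
    swap : ∀ a g c → a ℤ.* g ℤ.* c ≡ c ℤ.* g ℤ.* a
    swap = ℤ-Ring.solve-∀
    term : ∀ j i → entry G x y i j ≡ entry G y x j i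
    term j i rewrite G-sym i j = swap (lookup x i) (G j i) (lookup y j)

  ip-negʳ : ∀ x y → ip G x (neg y) ≡ ℤ.- ip G x y
  ip-negʳ x y = trans (ip-comm x (neg y)) (trans (ip-negˡ G y x) (cong ℤ.-_ (ip-comm y x)))

  ip-neg-neg : ∀ x → ip G (neg x) (neg x) ≡ ip G x x
  ip-neg-neg x = trans (ip-negˡ G x (neg x)) (trans (cong ℤ.-_ (ip-negʳ x x)) (ℤP.neg-involutive (ip G x x)))

  ip-norm-+ : ∀ x y → ip G (x +ᵥ y) (x +ᵥ y) ≡ ip G x x ℤ.+ (ip G x y ℤ.+ ip G x y) ℤ.+ ip G y y
  ip-norm-+ x y = begin
    ip G (x +ᵥ y) (x +ᵥ y)                               ≡⟨ ip-+ˡ G x y (x +ᵥ y) ⟩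
    ip G x (x +ᵥ y) ℤ.+ ip G y (x +ᵥ y)                  ≡⟨ cong₂ ℤ._+_ (ip-+ʳ x) (ip-+ʳ y) ⟩
    (ip G x x ℤ.+ ip G x y) ℤ.+ (ip G y x ℤ.+ ip G y y)
      ≡⟨ cong (λ t → (ip G x x ℤ.+ ip G x y) ℤ.+ (t ℤ.+ ip G y y)) (ip-comm y x) ⟩
    (ip G x x ℤ.+ ip G x y) ℤ.+ (ip G x y ℤ.+ ip G y y)  ≡⟨ regroup (ip G x x) (ip G x y) (ip G y y) ⟩
    ip G x x ℤ.+ (ip G x y ℤ.+ ip G x y) ℤ.+ ip G y y    ∎
    where
    open ≡-Reasoning
    ip-+ʳ : ∀ z → ip G z (x +ᵥ y) ≡ ip G z x ℤ.+ ip G z y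
    ip-+ʳ z = trans (ip-comm z (x +ᵥ y)) (trans (ip-+ˡ G x y z) (cong₂ ℤ._+_ (ip-comm x z) (ip-comm y z)))
    regroup : ∀ a b c → (a ℤ.+ b) ℤ.+ (b ℤ.+ c) ≡ a ℤ.+ (b ℤ.+ b) ℤ.+ c
    regroup = ℤ-Ring.solve-∀

i≤i+[j+j]+i⇒-j-j≤i : ∀ {i j} → i ℤ.≤ i ℤ.+ (j ℤ.+ j) ℤ.+ i → ℤ.- j ℤ.+ ℤ.- j ℤ.≤ i
i≤i+[j+j]+i⇒-j-j≤i {i} {j} i≤ = subst₂ ℤ._≤_ (left i j) (right i j) (ℤP.+-monoʳ-≤ (ℤ.- j ℤ.+ ℤ.- j ℤ.- i) i≤)
  where
  left : ∀ i j → (ℤ.- j ℤ.+ ℤ.- j ℤ.- i) ℤ.+ i ≡ ℤ.- j ℤ.+ ℤ.- j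
  left = ℤ-Ring.solve-∀
  right : ∀ i j → (ℤ.- j ℤ.+ ℤ.- j ℤ.- i) ℤ.+ (i ℤ.+ (j ℤ.+ j) ℤ.+ i) ≡ i
  right = ℤ-Ring.solve-∀

∣i∣+∣i∣≤n : ∀ {n} v → v ℤ.+ v ℤ.≤ + n → ℤ.- v ℤ.+ ℤ.- v ℤ.≤ + n → ∣ v ∣ ℕ.+ ∣ v ∣ ℕ.≤ n
∣i∣+∣i∣≤n (+ k)    2v≤n _     = ℤP.drop‿+≤+ 2v≤n
∣i∣+∣i∣≤n -[1+ k ] _    -2v≤n = ℤP.drop‿+≤+ -2v≤n

n+n≤7⇒n≤3 : ∀ {d} → d ℕ.+ d ℕ.≤ 7 → d ℕ.≤ 3
n+n≤7⇒n≤3 2d≤7 = ℕP.≮⇒≥ λ 3<d → ℕP.<-irrefl refl (ℕP.≤-trans (ℕP.+-mono-≤ 3<d 3<d) 2d≤7)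

module _ {n} {G : Gram n} (G-sym : Symmetric G) {m : ℕ}
         (minimal : ∀ x → x ≢ 0v → + m ℤ.≤ ip G x x) where

  minimal-neg-ip-bound : ∀ {x y} → ip G x x ≡ + m → ip G y y ≡ + m → x ≢ neg y →
                         ℤ.- ip G x y ℤ.+ ℤ.- ip G x y ℤ.≤ + m
  minimal-neg-ip-bound {x} {y} ∣x∣ ∣y∣ x≢-y =
    i≤i+[j+j]+i⇒-j-j≤i {+ m} {ip G x y} (subst (+ m ℤ.≤_) norm (minimal (x +ᵥ y) (x≢-y ∘ +ᵥ≡0v⇒≡neg x y)))
    where
    norm : ip G (x +ᵥ y) (x +ᵥ y) ≡ + m ℤ.+ (ip G x y ℤ.+ ip G x y) ℤ.+ + m
    norm = trans (ip-norm-+ G-sym x y) (cong₂ (λ a b → a ℤ.+ (ip G x y ℤ.+ ip G x y) ℤ.+ b) ∣x∣ ∣y∣)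

  minimal-∣ip∣-bound : ∀ {x α} → ip G x x ≡ + m → ip G α α ≡ + m → x ≢ α → x ≢ neg α →
                       ∣ ip G x α ∣ ℕ.+ ∣ ip G x α ∣ ℕ.≤ m
  minimal-∣ip∣-bound {x} {α} ∣x∣ ∣α∣ x≢α x≢-α = ∣i∣+∣i∣≤n (ip G x α) upper (minimal-neg-ip-bound ∣x∣ ∣α∣ x≢-α)
    where
    upper : ip G x α ℤ.+ ip G x α ℤ.≤ + m
    upper = subst (ℤ._≤ + m) (cong (λ v → v ℤ.+ v) -ip[x,-α]≡ip[x,α])
                  (minimal-neg-ip-bound ∣x∣ (trans (ip-neg-neg G-sym α) ∣α∣) (x≢α ∘ flip trans (neg-involutive α)))
      where
      -ip[x,-α]≡ip[x,α] : ℤ.- ip G x (neg α) ≡ ip G x α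
      -ip[x,-α]≡ip[x,α] = trans (cong ℤ.-_ (ip-negʳ G-sym x α)) (ℤP.neg-involutive (ip G x α))

_≡±ᵇ_ : ℤ → ℕ → Bool
v ≡±ᵇ i = does (v ℤ.≟ + i) ∨ does (v ℤ.≟ ℤ.- (+ i))

≡±ᵇ-suc : ∀ v j → (v ≡±ᵇ suc j) ≡ (∣ v ∣ ℕ.≡ᵇ suc j)
≡±ᵇ-suc (+ k)    j = ∨-identityʳ _
≡±ᵇ-suc -[1+ k ] j = refl

evenMoment : ℕ → ℚ × ℚ × ℚ → ℚ
evenMoment k (q₁ , q₂ , q₃) = q₁ + ℕ→ℚ (4 ℕ.^ k) * q₂ + ℕ→ℚ (9 ℕ.^ k) * q₃

evenMoment-zero : ∀ k → evenMoment k (0ℚ , 0ℚ , 0ℚ) ≡ 0ℚ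
evenMoment-zero k = annihilate (ℕ→ℚ (4 ℕ.^ k)) (ℕ→ℚ (9 ℕ.^ k))
  where
  annihilate : ∀ a b → 0ℚ + a * 0ℚ + b * 0ℚ ≡ 0ℚ
  annihilate = solve-∀ ℚ-ring

sumℚ-evenMoment : ∀ {A : Set} k (f₁ f₂ f₃ : A → ℚ) xs →
                  sumℚ (map (λ x → evenMoment k (f₁ x , f₂ x , f₃ x)) xs)
                  ≡ evenMoment k (sumℚ (map f₁ xs) , sumℚ (map f₂ xs) , sumℚ (map f₃ xs))
sumℚ-evenMoment k f₁ f₂ f₃ xs = begin
  sumℚ (map (λ x → f₁ x + w₂ * f₂ x + w₃ * f₃ x) xs)
    ≡⟨ sumℚ-+ _ (λ x → w₃ * f₃ x) xs ⟩
  sumℚ (map (λ x → f₁ x + w₂ * f₂ x) xs) + sumℚ (map (λ x → w₃ * f₃ x) xs)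
    ≡⟨ cong₂ _+_ (sumℚ-+ f₁ (λ x → w₂ * f₂ x) xs) (sumℚ-*ˡ w₃ f₃ xs) ⟩
  sumℚ (map f₁ xs) + sumℚ (map (λ x → w₂ * f₂ x) xs) + w₃ * sumℚ (map f₃ xs)
    ≡⟨ cong (λ t → sumℚ (map f₁ xs) + t + w₃ * sumℚ (map f₃ xs)) (sumℚ-*ˡ w₂ f₂ xs) ⟩
  sumℚ (map f₁ xs) + w₂ * sumℚ (map f₂ xs) + w₃ * sumℚ (map f₃ xs)
    ∎
  where
  open ≡-Reasoning
  w₂ = ℕ→ℚ (4 ℕ.^ k)
  w₃ = ℕ→ℚ (9 ℕ.^ k)

-- The coefficients of `recover` below are the rows of the inverse of ((1,4,9), (1,16,81), (1,64,729)).
evenMoment-injective : ∀ {p q} → evenMoment 1 p ≡ evenMoment 1 q → evenMoment 2 p ≡ evenMoment 2 q →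
                       evenMoment 3 p ≡ evenMoment 3 q → p ≡ q
evenMoment-injective {p@(p₁ , p₂ , p₃)} {q@(q₁ , q₂ , q₃)} e₁ e₂ e₃ =
  cong₂ _,_ (recover (λ m₁ m₂ m₃ → (+ 1 / 24) * (ℕ→ℚ 36 * m₁ - ℕ→ℚ 13 * m₂ + m₃))
                     (row₁ p₁ p₂ p₃) (row₁ q₁ q₂ q₃))
 (cong₂ _,_ (recover (λ m₁ m₂ m₃ → (+ 1 / 60) * (ℕ→ℚ 10 * m₂ - ℕ→ℚ 9 * m₁ - m₃))
                     (row₂ p₁ p₂ p₃) (row₂ q₁ q₂ q₃))
            (recover (λ m₁ m₂ m₃ → (+ 1 / 360) * (ℕ→ℚ 4 * m₁ - ℕ→ℚ 5 * m₂ + m₃))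
                     (row₃ p₁ p₂ p₃) (row₃ q₁ q₂ q₃)))
  where
  recover : ∀ (row : ℚ → ℚ → ℚ → ℚ) {x y} →
            row (evenMoment 1 p) (evenMoment 2 p) (evenMoment 3 p) ≡ x →
            row (evenMoment 1 q) (evenMoment 2 q) (evenMoment 3 q) ≡ y → x ≡ y
  recover row rp rq = trans (sym rp) (trans (cong₂ (λ m₁ (m₂ , m₃) → row m₁ m₂ m₃) e₁ (cong₂ _,_ e₂ e₃)) rq)
  row₁ : ∀ a b c → (+ 1 / 24) * (ℕ→ℚ 36 * (a + ℕ→ℚ 4 * b + ℕ→ℚ 9 * c)
                                 - ℕ→ℚ 13 * (a + ℕ→ℚ 16 * b + ℕ→ℚ 81 * c)
                                 + (a + ℕ→ℚ 64 * b + ℕ→ℚ 729 * c)) ≡ a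
  row₁ = solve-∀ ℚ-ring
  row₂ : ∀ a b c → (+ 1 / 60) * (ℕ→ℚ 10 * (a + ℕ→ℚ 16 * b + ℕ→ℚ 81 * c)
                                 - ℕ→ℚ 9 * (a + ℕ→ℚ 4 * b + ℕ→ℚ 9 * c)
                                 - (a + ℕ→ℚ 64 * b + ℕ→ℚ 729 * c)) ≡ b
  row₂ = solve-∀ ℚ-ring
  row₃ : ∀ a b c → (+ 1 / 360) * (ℕ→ℚ 4 * (a + ℕ→ℚ 4 * b + ℕ→ℚ 9 * c)
                                  - ℕ→ℚ 5 * (a + ℕ→ℚ 16 * b + ℕ→ℚ 81 * c)
                                  + (a + ℕ→ℚ 64 * b + ℕ→ℚ 729 * c)) ≡ c
  row₃ = solve-∀ ℚ-ring

ℕ→ℚ³ : ℕ × ℕ × ℕ → ℚ × ℚ × ℚ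
ℕ→ℚ³ (a , b , c) = ℕ→ℚ a , ℕ→ℚ b , ℕ→ℚ c

ℕ→ℚ³-injective : ∀ {a b} → ℕ→ℚ³ a ≡ ℕ→ℚ³ b → a ≡ b
ℕ→ℚ³-injective {_ , _ , _} {_ , _ , _} eq =
  cong₂ _,_ (ℕ→ℚ-injective (cong proj₁ eq))
            (cong₂ _,_ (ℕ→ℚ-injective (cong (proj₁ ∘ proj₂) eq)) (ℕ→ℚ-injective (cong (proj₂ ∘ proj₂) eq)))

small-even-power : ∀ {d} k → d ℕ.≤ 3 →
  ℕ→ℚ ((d ℕ.* d) ℕ.^ suc k) ≡ evenMoment (suc k) (ind (d ℕ.≡ᵇ 1) , ind (d ℕ.≡ᵇ 2) , ind (d ℕ.≡ᵇ 3))
small-even-power k z≤n                   = sym (evenMoment-zero (suc k))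
small-even-power k (s≤s z≤n)             =
  trans (cong ℕ→ℚ (ℕP.^-zeroˡ (suc k))) (pick₁ (ℕ→ℚ (4 ℕ.^ suc k)) (ℕ→ℚ (9 ℕ.^ suc k)))
  where
  pick₁ : ∀ a b → 1ℚ ≡ 1ℚ + a * 0ℚ + b * 0ℚ
  pick₁ = solve-∀ ℚ-ring
small-even-power k (s≤s (s≤s z≤n))       = pick₂ (ℕ→ℚ (4 ℕ.^ suc k)) (ℕ→ℚ (9 ℕ.^ suc k))
  where
  pick₂ : ∀ a b → a ≡ 0ℚ + a * 1ℚ + b * 0ℚ
  pick₂ = solve-∀ ℚ-ring
small-even-power k (s≤s (s≤s (s≤s z≤n))) = pick₃ (ℕ→ℚ (4 ℕ.^ suc k)) (ℕ→ℚ (9 ℕ.^ suc k))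
  where
  pick₃ : ∀ a b → b ≡ 0ℚ + a * 0ℚ + b * 1ℚ
  pick₃ = solve-∀ ℚ-ring

module _ (n : ℕ) .{{_ : NonZero n}} where

  c-suc : ∀ i → c n (suc i) ≡ c n i * (ℕ→ℚ (1 ℕ.+ 2 ℕ.* i) * _/_ (+ 1) (2 ℕ.* i ℕ.+ n) {{nz+ (2 ℕ.* i) n}})
  c-suc i = cong (c n i *_) (n/d≡n*[1/d] (1 ℕ.+ 2 ℕ.* i) (2 ℕ.* i ℕ.+ n) {{nz+ (2 ℕ.* i) n}})

  private
    q₀ q₁ q₂ q₃ : ℚ
    q₀ = + 1 / n
    q₁ = + 1 / (2 ℕ.+ n)
    q₂ = + 1 / (4 ℕ.+ n)
    q₃ = + 1 / (6 ℕ.+ n)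

    c₂≡ : c n 2 ≡ 1ℚ * q₀ * (ℕ→ℚ 3 * q₁)
    c₂≡ = c-suc 1

    c₃≡ : c n 3 ≡ 1ℚ * q₀ * (ℕ→ℚ 3 * q₁) * (ℕ→ℚ 5 * q₂)
    c₃≡ = trans (c-suc 2) (cong (_* (ℕ→ℚ 5 * q₂)) c₂≡)

    c₄≡ : c n 4 ≡ 1ℚ * q₀ * (ℕ→ℚ 3 * q₁) * (ℕ→ℚ 5 * q₂) * (ℕ→ℚ 7 * q₃)
    c₄≡ = trans (c-suc 3) (cong (_* (ℕ→ℚ 7 * q₃)) c₃≡)

  c₁-closed-form : ∀ L P → c n 1 * L * P ≡ L * P * q₀
  c₁-closed-form L P = reorder q₀ L P
    where
    reorder : ∀ q₀ L P → 1ℚ * q₀ * L * P ≡ L * P * q₀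
    reorder = solve-∀ ℚ-ring

  c₂-closed-form : ∀ L P → c n 2 * L * P ≡ ℕ→ℚ 3 * L * P * q₀ * q₁
  c₂-closed-form L P = trans (cong (λ c₂ → c₂ * L * P) c₂≡) (reorder q₀ q₁ L P)
    where
    reorder : ∀ q₀ q₁ L P → 1ℚ * q₀ * (ℕ→ℚ 3 * q₁) * L * P ≡ ℕ→ℚ 3 * L * P * q₀ * q₁
    reorder = solve-∀ ℚ-ring

  c₃-closed-form : ∀ L P → c n 3 * L * P ≡ ℕ→ℚ 15 * L * P * q₀ * q₁ * q₂
  c₃-closed-form L P = trans (cong (λ c₃ → c₃ * L * P) c₃≡) (reorder q₀ q₁ q₂ L P)
    where
    reorder : ∀ q₀ q₁ q₂ L P →
              1ℚ * q₀ * (ℕ→ℚ 3 * q₁) * (ℕ→ℚ 5 * q₂) * L * P ≡ ℕ→ℚ 15 * L * P * q₀ * q₁ * q₂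
    reorder = solve-∀ ℚ-ring

  c₄-closed-form : ∀ L P → c n 4 * L * P ≡ ℕ→ℚ 105 * L * P * q₀ * q₁ * q₂ * q₃
  c₄-closed-form L P = trans (cong (λ c₄ → c₄ * L * P) c₄≡) (reorder q₀ q₁ q₂ q₃ L P)
    where
    reorder : ∀ q₀ q₁ q₂ q₃ L P → 1ℚ * q₀ * (ℕ→ℚ 3 * q₁) * (ℕ→ℚ 5 * q₂) * (ℕ→ℚ 7 * q₃) * L * P
                                  ≡ ℕ→ℚ 105 * L * P * q₀ * q₁ * q₂ * q₃
    reorder = solve-∀ ℚ-ring

halve-moment : ∀ {μ e} C L P → (μ + e) + (μ + e) ≡ C * (L + L) * P → e ≡ C * L * P - μ
halve-moment {μ} {e} C L P doubled = begin
  e                                    ≡⟨ unhalve μ e ⟩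
  (+ 1 / 2) * ((μ + e) + (μ + e)) - μ  ≡⟨ cong (λ t → (+ 1 / 2) * t - μ) doubled ⟩
  (+ 1 / 2) * (C * (L + L) * P) - μ    ≡⟨ halve C L P μ ⟩
  C * L * P - μ                        ∎
  where
  open ≡-Reasoning
  unhalve : ∀ μ e → e ≡ (+ 1 / 2) * ((μ + e) + (μ + e)) - μ
  unhalve = solve-∀ ℚ-ring
  halve : ∀ C L P μ → (+ 1 / 2) * (C * (L + L) * P) - μ ≡ C * L * P - μ
  halve = solve-∀ ℚ-ring

module Configuration {n} .{{_ : NonZero n}} (G : Gram n) (G-sym : Symmetric G) (m : ℕ)
  (minimal : ∀ x → x ≢ 0v → + m ℤ.≤ ip G x x) (m≤7 : m ℕ.≤ 7)
  (S : List (Vec ℤ n)) (unique : Unique S) (norm : ∀ {x} → x ∈ S → ip G x x ≡ + m)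
  (design : IsSphericalDesign G m 4 S)
  (X : List (Vec ℤ n)) (split : X ++ map neg X ↭ S) where

  M : ℚ
  M = ℕ→ℚ m

  X⊆S : ∀ {x} → x ∈ X → x ∈ S
  X⊆S x∈X = ∈-resp-↭ split (∈-++⁺ˡ x∈X)

  length-S : length S ≡ length X ℕ.+ length X
  length-S = trans (sym (↭-length split)) (trans (length-++ X) (cong (length X ℕ.+_) (length-map neg X)))

  counts : Vec ℤ n → ℕ × ℕ × ℕ
  counts α = sIdx G X α 1 , sIdx G X α 2 , sIdx G X α 3

  module At {α : Vec ℤ n} (α∈S : α ∈ S) where

    -- sIdx G X α i is definitionally length (filterᵇ (shell i) X).
    shell : ℕ → Vec ℤ n → Bool
    shell i x = not (does (x ≟ᵥ α)) ∧ not (does (x ≟ᵥ neg α)) ∧ (ip G x α ≡±ᵇ i)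

    shell-±α : ∀ {y} → y ≡ α ⊎ y ≡ neg α → ∀ i → shell i y ≡ false
    shell-±α (inj₁ refl) i =
      cong (λ b → not b ∧ not (does (α ≟ᵥ neg α)) ∧ (ip G α α ≡±ᵇ i)) (dec-true (α ≟ᵥ α) refl)
    shell-±α (inj₂ refl) i = trans (cong (λ b → not (does (neg α ≟ᵥ α)) ∧ not b ∧ (ip G (neg α) α ≡±ᵇ i))
                                         (dec-true (neg α ≟ᵥ neg α) refl))
                                   (∧-zeroʳ _)

    shell-off : ∀ {x} → x ≢ α → x ≢ neg α → ∀ j → shell (suc j) x ≡ (∣ ip G x α ∣ ℕ.≡ᵇ suc j)
    shell-off {x} x≢α x≢-α j = trans (cong₂ (λ a b → not a ∧ not b ∧ (ip G x α ≡±ᵇ suc j))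
                                            (dec-false (x ≟ᵥ α) x≢α) (dec-false (x ≟ᵥ neg α) x≢-α))
                                     (≡±ᵇ-suc (ip G x α) j)

    ∣ip∣≤3 : ∀ {x} → x ∈ S → x ≢ α → x ≢ neg α → ∣ ip G x α ∣ ℕ.≤ 3
    ∣ip∣≤3 x∈S x≢α x≢-α =
      n+n≤7⇒n≤3 (ℕP.≤-trans (minimal-∣ip∣-bound G-sym minimal (norm x∈S) (norm α∈S) x≢α x≢-α) m≤7)

    shells : Vec ℤ n → ℚ × ℚ × ℚ
    shells x = ind (shell 1 x) , ind (shell 2 x) , ind (shell 3 x)

    power : ℕ → Vec ℤ n → ℚ
    power k x = ℤ→ℚ (ip G x α) ^ℚ (2 ℕ.* k)

    shells-±α : ∀ {y} → y ≡ α ⊎ y ≡ neg α → shells y ≡ (0ℚ , 0ℚ , 0ℚ)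
    shells-±α ±α = cong₂ _,_ (cong ind (shell-±α ±α 1))
                             (cong₂ _,_ (cong ind (shell-±α ±α 2)) (cong ind (shell-±α ±α 3)))

    shells-off : ∀ {x} → x ≢ α → x ≢ neg α →
                 shells x ≡ (ind (∣ ip G x α ∣ ℕ.≡ᵇ 1) , ind (∣ ip G x α ∣ ℕ.≡ᵇ 2) , ind (∣ ip G x α ∣ ℕ.≡ᵇ 3))
    shells-off x≢α x≢-α = cong₂ _,_ (cong ind (shell-off x≢α x≢-α 0))
                                    (cong₂ _,_ (cong ind (shell-off x≢α x≢-α 1)) (cong ind (shell-off x≢α x≢-α 2)))

    shell-vanishes : ∀ {x} → x ∈ S → ∀ i → 3 ℕ.< i → shell i x ≡ false
    shell-vanishes {x} x∈S (suc j) 3<i with x ≟ᵥ α | x ≟ᵥ neg α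
    ... | yes _   | _       = refl
    ... | no _    | yes _   = refl
    ... | no x≢α  | no x≢-α = trans (≡±ᵇ-suc (ip G x α) j)
      (dec-false (∣ ip G x α ∣ ℕ.≟ suc j) (ℕP.<⇒≢ (ℕP.≤-<-trans (∣ip∣≤3 x∈S x≢α x≢-α) 3<i)))

    power-neg : ∀ k x → power k (neg x) ≡ power k x
    power-neg k x = begin
      ℤ→ℚ (ip G (neg x) α) ^ℚ (2 ℕ.* k)                    ≡⟨ cong (λ v → ℤ→ℚ v ^ℚ (2 ℕ.* k)) (ip-negˡ G x α) ⟩
      ℤ→ℚ (ℤ.- v) ^ℚ (2 ℕ.* k)                             ≡⟨ even-power-∣∣ (ℤ.- v) k ⟩
      ℕ→ℚ ((∣ ℤ.- v ∣ ℕ.* ∣ ℤ.- v ∣) ℕ.^ k)                 ≡⟨ cong (λ d → ℕ→ℚ ((d ℕ.* d) ℕ.^ k)) (ℤP.∣-i∣≡∣i∣ v) ⟩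
      ℕ→ℚ ((∣ v ∣ ℕ.* ∣ v ∣) ℕ.^ k)                         ≡⟨ even-power-∣∣ v k ⟨
      power k x                                            ∎
      where
      open ≡-Reasoning
      v = ip G x α

    power-±α : ∀ k {y} → y ≡ α ⊎ y ≡ neg α → power k y ≡ M ^ℚ (2 ℕ.* k)
    power-±α k (inj₁ refl) = cong (λ v → ℤ→ℚ v ^ℚ (2 ℕ.* k)) (norm α∈S)
    power-±α k (inj₂ refl) = trans (power-neg k α) (power-±α k (inj₁ refl))

    power-off : ∀ k {x} → x ∈ S → x ≢ α → x ≢ neg α → power (suc k) x ≡ evenMoment (suc k) (shells x)
    power-off k {x} x∈S x≢α x≢-α = begin
      power (suc k) x
        ≡⟨ even-power-∣∣ (ip G x α) (suc k) ⟩
      ℕ→ℚ ((d ℕ.* d) ℕ.^ suc k)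
        ≡⟨ small-even-power k (∣ip∣≤3 x∈S x≢α x≢-α) ⟩
      evenMoment (suc k) (ind (d ℕ.≡ᵇ 1) , ind (d ℕ.≡ᵇ 2) , ind (d ℕ.≡ᵇ 3))
        ≡⟨ cong (evenMoment (suc k)) (shells-off x≢α x≢-α) ⟨
      evenMoment (suc k) (shells x)
        ∎
      where
      open ≡-Reasoning
      d = ∣ ip G x α ∣

    ±α-occurrences : sumℚ (map (λ x → ind (does (x ≟ᵥ α)) + ind (does (x ≟ᵥ neg α))) X) ≡ 1ℚ
    ±α-occurrences = begin
      sumℚ (map (λ x → isα x + ind (does (x ≟ᵥ neg α))) X)
        ≡⟨ sumℚ-cong {xs = X} (λ {x} _ → cong (λ b → isα x + ind b) (does-≟ᵥ-neg x α)) ⟩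
      sumℚ (map (λ x → isα x + isα (neg x)) X)             ≡⟨ sumℚ-↭-++-map isα neg X split ⟨
      sumℚ (map isα S)                                     ≡⟨ sumℚ-ind (_≟ᵥ α) S ⟩
      ℕ→ℚ (length (filter (_≟ᵥ α) S))                      ≡⟨ cong ℕ→ℚ (length-filter-≟-unique _≟ᵥ_ unique α∈S) ⟩
      1ℚ                                                   ∎
      where
      open ≡-Reasoning
      isα : Vec ℤ n → ℚ
      isα x = ind (does (x ≟ᵥ α))

    -- If α = -α, every x ∈ X would be counted twice in ±α-occurrences, making 1 even.
    α≢negα : α ≢ neg α
    α≢negα α≡-α = ℕP.even≢odd #α 0 (trans (cong (#α ℕ.+_) (ℕP.+-identityʳ #α)) (ℕ→ℚ-injective (begin
      ℕ→ℚ (#α ℕ.+ #α)                                        ≡⟨ ℕ→ℚ-homo-+ #α #α ⟩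
      ℕ→ℚ #α + ℕ→ℚ #α                                      ≡⟨ cong₂ _+_ (sumℚ-ind (_≟ᵥ α) X) (sumℚ-ind (_≟ᵥ α) X) ⟨
      sumℚ (map isα X) + sumℚ (map isα X)                  ≡⟨ sumℚ-+ isα isα X ⟨
      sumℚ (map (λ x → isα x + isα x) X)
        ≡⟨ cong (λ β → sumℚ (map (λ x → isα x + ind (does (x ≟ᵥ β))) X)) α≡-α ⟩
      sumℚ (map (λ x → isα x + ind (does (x ≟ᵥ neg α))) X) ≡⟨ ±α-occurrences ⟩
      1ℚ                                                   ∎)))
      where
      open ≡-Reasoning
      isα : Vec ℤ n → ℚ
      isα x = ind (does (x ≟ᵥ α))
      #α = length (filter (_≟ᵥ α) X)

    power-±α-split : ∀ k {y} → y ≡ α ⊎ y ≡ neg α →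
                     power (suc k) y ≡ 1ℚ * M ^ℚ (2 ℕ.* suc k) + evenMoment (suc k) (shells y)
    power-±α-split k {y} ±α = trans (power-±α (suc k) ±α) (sym (begin
      1ℚ * μ + evenMoment (suc k) (shells y)
        ≡⟨ cong₂ _+_ (ℚP.*-identityˡ μ) (cong (evenMoment (suc k)) (shells-±α ±α)) ⟩
      μ + evenMoment (suc k) (0ℚ , 0ℚ , 0ℚ)   ≡⟨ cong (μ ℚ.+_) (evenMoment-zero (suc k)) ⟩
      μ + 0ℚ                                   ≡⟨ ℚP.+-identityʳ μ ⟩
      μ                                        ∎))
      where
      open ≡-Reasoning
      μ = M ^ℚ (2 ℕ.* suc k)

    power-split : ∀ k {x} → x ∈ S → power (suc k) x
      ≡ (ind (does (x ≟ᵥ α)) + ind (does (x ≟ᵥ neg α))) * M ^ℚ (2 ℕ.* suc k) + evenMoment (suc k) (shells x)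
    power-split k {x} x∈S = by-cases (x ≟ᵥ α) (x ≟ᵥ neg α)
      where
      μ = M ^ℚ (2 ℕ.* suc k)
      by-cases : (x≟α : Dec (x ≡ α)) (x≟-α : Dec (x ≡ neg α)) →
                 power (suc k) x ≡ (ind (does x≟α) + ind (does x≟-α)) * μ + evenMoment (suc k) (shells x)
      by-cases (yes x≡α) (yes x≡-α) = ⊥-elim (α≢negα (trans (sym x≡α) x≡-α))
      by-cases (yes x≡α) (no _)     = power-±α-split k (inj₁ x≡α)
      by-cases (no _)    (yes x≡-α) = power-±α-split k (inj₂ x≡-α)
      by-cases (no x≢α)  (no x≢-α)  = trans (power-off k x∈S x≢α x≢-α)
        (sym (trans (cong (_+ evenMoment (suc k) (shells x)) (ℚP.*-zeroˡ μ)) (ℚP.+-identityˡ _)))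

    sum-power : ∀ k → sumℚ (map (power (suc k)) X) ≡ M ^ℚ (2 ℕ.* suc k) + evenMoment (suc k) (ℕ→ℚ³ (counts α))
    sum-power k = begin
      sumℚ (map (power (suc k)) X)
        ≡⟨ sumℚ-cong (power-split k ∘ X⊆S) ⟩
      sumℚ (map (λ x → occ x * μ + evenMoment (suc k) (shells x)) X)
        ≡⟨ sumℚ-+ (λ x → occ x * μ) (evenMoment (suc k) ∘ shells) X ⟩
      sumℚ (map (λ x → occ x * μ) X) + sumℚ (map (evenMoment (suc k) ∘ shells) X)
        ≡⟨ cong₂ _+_ (sumℚ-*ʳ μ occ X) (sumℚ-evenMoment (suc k) (counted 1) (counted 2) (counted 3) X) ⟩
      sumℚ (map occ X) * μ + evenMoment (suc k) (Σ (counted 1) , Σ (counted 2) , Σ (counted 3))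
        ≡⟨ cong₂ _+_ (trans (cong (_* μ) ±α-occurrences) (ℚP.*-identityˡ μ)) (cong (evenMoment (suc k)) counts≡) ⟩
      μ + evenMoment (suc k) (ℕ→ℚ³ (counts α))
        ∎
      where
      open ≡-Reasoning
      μ = M ^ℚ (2 ℕ.* suc k)
      occ : Vec ℤ n → ℚ
      occ x = ind (does (x ≟ᵥ α)) + ind (does (x ≟ᵥ neg α))
      counted : ℕ → Vec ℤ n → ℚ
      counted i = ind ∘ shell i
      Σ : (Vec ℤ n → ℚ) → ℚ
      Σ f = sumℚ (map f X)
      counts≡ : (Σ (counted 1) , Σ (counted 2) , Σ (counted 3)) ≡ ℕ→ℚ³ (counts α)
      counts≡ = cong₂ _,_ (sumℚ-ind (T? ∘ shell 1) X)
                          (cong₂ _,_ (sumℚ-ind (T? ∘ shell 2) X) (sumℚ-ind (T? ∘ shell 3) X))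

    doubled-sum-power : ∀ k → suc k ℕ.≤ 4 →
      sumℚ (map (power (suc k)) X) + sumℚ (map (power (suc k)) X)
      ≡ c n (suc k) * (ℕ→ℚ (length X) + ℕ→ℚ (length X)) * (M ^ℚ suc k * M ^ℚ suc k)
    doubled-sum-power k k<4 = begin
      sumℚ (map p X) + sumℚ (map p X)                     ≡⟨ sumℚ-+ p p X ⟨
      sumℚ (map (λ x → p x + p x) X)
        ≡⟨ sumℚ-cong {xs = X} (λ {x} _ → cong (p x ℚ.+_) (power-neg (suc k) x)) ⟨
      sumℚ (map (λ x → p x + p (neg x)) X)                ≡⟨ sumℚ-↭-++-map p neg X split ⟨
      sumℚ (map p S)                                      ≡⟨ sumℚ-cong {xs = S} (λ {x} _ → cong (_^ℚ 2k) (ipℚ-toℚ G x α)) ⟨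
      sumℚ (map (λ x → ipℚ G (toℚ x) (toℚ α) ^ℚ 2k) S)    ≡⟨ proj₂ (proj₂ design) (suc k) k<4 (toℚ α) ⟩
      C * ℕ→ℚ (length S) * Mᵏ * ipℚ G (toℚ α) (toℚ α) ^ℚ suc k
        ≡⟨ cong₂ (λ l q → C * l * Mᵏ * q ^ℚ suc k)
                 (trans (cong ℕ→ℚ length-S) (ℕ→ℚ-homo-+ (length X) (length X)))
                 (trans (ipℚ-toℚ G α α) (cong ℤ→ℚ (norm α∈S))) ⟩
      C * (L + L) * Mᵏ * Mᵏ                               ≡⟨ ℚP.*-assoc (C * (L + L)) Mᵏ Mᵏ ⟩
      C * (L + L) * (Mᵏ * Mᵏ)                             ∎
      where
      open ≡-Reasoning
      p  = power (suc k)
      2k = 2 ℕ.* suc k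
      C  = c n (suc k)
      L  = ℕ→ℚ (length X)
      Mᵏ = M ^ℚ suc k

    evenMoment-formula : ∀ k → suc k ℕ.≤ 4 →
      evenMoment (suc k) (ℕ→ℚ³ (counts α)) ≡ c n (suc k) * ℕ→ℚ (length X) * M ^ℚ (2 ℕ.* suc k) - M ^ℚ (2 ℕ.* suc k)
    evenMoment-formula k k<4 =
      trans (halve-moment (c n (suc k)) (ℕ→ℚ (length X)) (M ^ℚ suc k * M ^ℚ suc k)
                          (subst (λ A → A + A ≡ _) (sum-power k) (doubled-sum-power k k<4)))
            (cong (λ P → c n (suc k) * ℕ→ℚ (length X) * P - M ^ℚ (2 ℕ.* suc k)) square)
      where
      square : M ^ℚ suc k * M ^ℚ suc k ≡ M ^ℚ (2 ℕ.* suc k)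
      square = sym (trans (^ℚ-even M (suc k)) (^ℚ-distrib-* M M (suc k)))

  counts-constant : ∀ {α β} → α ∈ S → β ∈ S → counts α ≡ counts β
  counts-constant {α} {β} α∈S β∈S =
    ℕ→ℚ³-injective (evenMoment-injective (same 0 (s≤s z≤n)) (same 1 (s≤s (s≤s z≤n))) (same 2 (s≤s (s≤s (s≤s z≤n)))))
    where
    same : ∀ k → suc k ℕ.≤ 4 → evenMoment (suc k) (ℕ→ℚ³ (counts α)) ≡ evenMoment (suc k) (ℕ→ℚ³ (counts β))
    same k k<4 = trans (At.evenMoment-formula α∈S k k<4) (sym (At.evenMoment-formula β∈S k k<4))

  outer-shells-empty : ∀ {α} → α ∈ S → ∀ i → 3 ℕ.< i → sIdx G X α i ≡ 0
  outer-shells-empty α∈S i 3<i =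
    cong length (filter-none (T? ∘ shell i) (All.tabulate λ x∈X → subst T (shell-vanishes (X⊆S x∈X) i 3<i)))
    where open At α∈S

lemma3p1 : (n : ℕ) .{{_ : NonZero n}} (G : Gram n) → Symmetric G → PositiveDefinite G
    → (m : ℕ) → IsMin G m → m ≤ 7
    → (S : List (Vec ℤ n)) → Unique S → EnumeratesMinVecs G m S
    → IsSphericalDesign G m 4 S
    → (X : List (Vec ℤ n)) → (X ++ map neg X) ↭ S
    → ∃ λ (s₁ : ℕ) → ∃ λ (s₂ : ℕ) → ∃ λ (s₃ : ℕ)
        → (∀ α → α ∈ S → sIdx G X α 1 ≡ s₁ × sIdx G X α 2 ≡ s₂ × sIdx G X α 3 ≡ s₃
                         × (∀ i → 3 < i → sIdx G X α i ≡ 0))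
        × (ℕ→ℚ s₁ + ℕ→ℚ 4 * ℕ→ℚ s₂ + ℕ→ℚ 9 * ℕ→ℚ s₃
             ≡ (+ (length X) / 1) * (ℕ→ℚ m ^ℚ 2) * (+ 1 / n) - (ℕ→ℚ m ^ℚ 2))
        × (ℕ→ℚ s₁ + ℕ→ℚ 16 * ℕ→ℚ s₂ + ℕ→ℚ 81 * ℕ→ℚ s₃
             ≡ ℕ→ℚ 3 * ℕ→ℚ (length X) * (ℕ→ℚ m ^ℚ 4) * (+ 1 / n) * (+ 1 / (2 Data.Nat.+ n))
               - (ℕ→ℚ m ^ℚ 4))
        × (ℕ→ℚ s₁ + ℕ→ℚ 64 * ℕ→ℚ s₂ + ℕ→ℚ 729 * ℕ→ℚ s₃
             ≡ ℕ→ℚ 15 * ℕ→ℚ (length X) * (ℕ→ℚ m ^ℚ 6) * (+ 1 / n) * (+ 1 / (2 Data.Nat.+ n))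
               * (+ 1 / (4 Data.Nat.+ n)) - (ℕ→ℚ m ^ℚ 6))
        × (ℕ→ℚ s₁ + ℕ→ℚ 256 * ℕ→ℚ s₂ + ℕ→ℚ 6561 * ℕ→ℚ s₃
             ≡ ℕ→ℚ 105 * ℕ→ℚ (length X) * (ℕ→ℚ m ^ℚ 8) * (+ 1 / n) * (+ 1 / (2 Data.Nat.+ n))
               * (+ 1 / (4 Data.Nat.+ n)) * (+ 1 / (6 Data.Nat.+ n)) - (ℕ→ℚ m ^ℚ 8))
lemma3p1 n G G-sym _ m ((α₀ , _ , ∣α₀∣) , minimal) m≤7 S unique enumerates design X split =
  s 1 , s 2 , s 3 , regular ,
  trans (formula 0 (s≤s z≤n))                         (cong (_- M ^ℚ 2) (c₁-closed-form n L (M ^ℚ 2))) ,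
  trans (formula 1 (s≤s (s≤s z≤n)))                   (cong (_- M ^ℚ 4) (c₂-closed-form n L (M ^ℚ 4))) ,
  trans (formula 2 (s≤s (s≤s (s≤s z≤n))))             (cong (_- M ^ℚ 6) (c₃-closed-form n L (M ^ℚ 6))) ,
  trans (formula 3 (s≤s (s≤s (s≤s (s≤s z≤n)))))       (cong (_- M ^ℚ 8) (c₄-closed-form n L (M ^ℚ 8)))
  where
  open Configuration G G-sym m minimal m≤7 S unique (λ {x} → proj₁ (enumerates x)) design X split
  α₀∈S : α₀ ∈ S
  α₀∈S = proj₂ (enumerates α₀) ∣α₀∣
  open At α₀∈S renaming (evenMoment-formula to formula)
  s : ℕ → ℕ
  s = sIdx G X α₀
  L : ℚ
  L = ℕ→ℚ (length X)
  regular : ∀ α → α ∈ S → sIdx G X α 1 ≡ s 1 × sIdx G X α 2 ≡ s 2 × sIdx G X α 3 ≡ s 3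
                         × (∀ i → 3 < i → sIdx G X α i ≡ 0)
  regular α α∈S =
    cong proj₁ same , cong (proj₁ ∘ proj₂) same , cong (proj₂ ∘ proj₂) same , outer-shells-empty α∈S
    where
    same = counts-constant α∈S α₀∈S
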